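{- For $n\geq 1$ let $\mathcal{P}_{3n}$ be the set of permutations $\pi$ of length $3n$ that avoid the patterns $231$, $312$ and $321$ and satisfy $\pi_{3i+1}<\pi_{3i+2}$ and $\pi_{3i+1}<\pi_{3i+3}$ for all $i\in\{0,1,\dots,n-1\}$. Define $P_3=\{123,132\}$ and, for $n\geq 2$, \[P_{3n}=\{\,1\oplus\tau\oplus \mathrm{red}(\pi_2\pi_3\cdots\pi_{3n-3}) : \tau\in\{123,132,213\},\ \pi\in\mathcal{P}_{3n-3}\,\}.\] Then $P_{3n}=\mathcal{P}_{3n}$ for all $n\geq 1$.
   Context: For permutations $\alpha$ of length $a$ and $\beta$ of length $b$, the direct sum $\alpha\oplus\beta$ is the permutation of length $a+b$ whose first $a$ entries are $\alpha_1,\dots,\alpha_a$ and whose last $b$ entries are $\beta_1+a,\dots,\beta_b+a$. $\mathrm{red}(w)$ of a sequence $w$ of distinct integers of length $m$ is the unique $m$-permutation order-isomorphic to $w$. Pattern containment: $\pi$ contains $p$ if some subsequence of $\pi$ is order-isomorphic to $p$. -}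

module Defs where

open import Data.Nat using (ℕ; zero; suc; _+_; _*_; _<_; _<ᵇ_)
open import Data.Bool using (if_then_else_)
open import Data.List using (List; []; _∷_; _++_; map; length; upTo; drop; foldr)
open import Data.List.Relation.Binary.Permutation.Propositional using (_↭_)
open import Data.List.Relation.Binary.Sublist.Propositional using (_⊆_)
open import Data.List.Membership.Propositional using (_∈_)
open import Data.Product using (Σ; _×_; ∃-syntax)
open import Data.Sum using (_⊎_)
open import Data.Unit using (⊤)
open import Data.Empty using (⊥)
open import Relation.Nullary using (¬_)
open import Relation.Binary.PropositionalEquality using (_≡_)

-- Permutations are lists of naturals (one-line notation, values 1..m).
-- π is a permutation of length m iff it is a rearrangement of [1, 2, ..., m].
IsPerm : ℕ → List ℕ → Set
IsPerm m π = π ↭ map suc (upTo m)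

countLess : ℕ → List ℕ → ℕ
countLess x = foldr (λ y c → if y <ᵇ x then suc c else c) 0

-- red(w): for a sequence of distinct integers, replace each entry by its rank
-- (1 + number of entries smaller than it): the unique order-isomorphic permutation.
red : List ℕ → List ℕ
red w = map (λ x → suc (countLess x w)) w

_⊕_ : List ℕ → List ℕ → List ℕ
α ⊕ β = α ++ map (_+ length α) β
infixl 6 _⊕_

Contains : List ℕ → List ℕ → Set
Contains π p = ∃[ σ ] (σ ⊆ π × red σ ≡ p)

Avoids : List ℕ → List ℕ → Set
Avoids π p = ¬ Contains π p

-- π_{3i+1} < π_{3i+2} and π_{3i+1} < π_{3i+3} for every block i
-- (also forces the length to be a multiple of 3)
Blocks : List ℕ → Set
Blocks [] = ⊤
Blocks (a ∷ b ∷ c ∷ rest) = (a < b × a < c) × Blocks rest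
Blocks _ = ⊥

𝒫 : ℕ → List ℕ → Set
𝒫 n π = IsPerm (3 * n) π
      × Avoids π (2 ∷ 3 ∷ 1 ∷ [])
      × Avoids π (3 ∷ 1 ∷ 2 ∷ [])
      × Avoids π (3 ∷ 2 ∷ 1 ∷ [])
      × Blocks π

-- the set P_{3n}, defined for n ≥ 1 (argument k means n = k + 1)
P : ℕ → List ℕ → Set
P zero π = π ≡ (1 ∷ 2 ∷ 3 ∷ []) ⊎ π ≡ (1 ∷ 3 ∷ 2 ∷ [])
P (suc k) π =
  ∃[ τ ] ∃[ σ ]
    ( τ ∈ ((1 ∷ 2 ∷ 3 ∷ []) ∷ (1 ∷ 3 ∷ 2 ∷ []) ∷ (2 ∷ 1 ∷ 3 ∷ []) ∷ [])
    × 𝒫 (suc k) σ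
    × π ≡ ((1 ∷ []) ⊕ τ ⊕ red (drop 1 σ)) )

-- A permutation avoids 231, 312 and 321 exactly when it is a direct sum of copies of 1 and 21.
-- For such a permutation the block condition says that no layer 21 starts at a position 3i+1.
-- Hence an element of 𝒫_{3n} is 1 ⊕ ρ where no layer of ρ occupies its positions 3 and 4, so
-- ρ = τ ⊕ ρ′ with τ ∈ {123, 132, 213} (the direct sums of 1 and 21 of length 3) and ρ′ of the
-- same kind as ρ; then σ = 1 ⊕ ρ′ lies in 𝒫_{3n-3} and red(σ₂⋯σ_{3n-3}) = ρ′.
module Submission where

open import Defs
open import Data.Nat using (ℕ; zero; suc; _+_; _*_; _<_; _≤_; _<ᵇ_; z≤n; s≤s; z<s; s<s; _≟_)
open import Data.Nat.Properties
open import Data.Bool using (true; false; T)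
open import Data.Bool.Properties using (T-≡; ¬-not)
open import Data.Empty using (⊥; ⊥-elim)
open import Data.List using (List; []; _∷_; _++_; map; length; upTo; applyUpTo; drop)
open import Data.List.Properties
  using (length-map; length-++; length-upTo; map-upTo; map-++; map-∘; map-cong; map-id-local; ++-assoc)
open import Data.List.Membership.Propositional using (_∈_)
open import Data.List.Relation.Unary.Any as Any using (here; there)
open import Data.List.Relation.Unary.All as All using (All; []; _∷_)
import Data.List.Relation.Unary.AllPairs as AllPairs
open import Data.List.Relation.Unary.Unique.Propositional using (Unique)
open import Data.List.Relation.Unary.Unique.Propositional.Properties using (map⁺; upTo⁺)
open import Data.List.Relation.Binary.Permutation.Propositional
  using (_↭_; prep; swap; ↭-refl; ↭-sym; ↭-trans; ↭⇒↭ₛ)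
open import Data.List.Relation.Binary.Permutation.Propositional.Properties
  using (∈-resp-↭; ↭-length; drop-∷)
open import Data.List.Relation.Binary.Sublist.Propositional {A = ℕ}
  using (_⊆_; _∷ʳ_; _∷_; lookup; from∈)
open import Data.Product using (_×_; _,_; proj₁; proj₂; ∃-syntax)
open import Data.Sum using (_⊎_; inj₁; inj₂)
open import Data.Unit using (tt)
open import Function using (_∘_)
open import Function.Bundles using (_⇔_; mk⇔; Equivalence)
open import Relation.Nullary using (yes; no)
open import Relation.Binary.PropositionalEquality
  using (_≡_; _≢_; refl; sym; trans; cong; cong₂; subst; setoid; module ≡-Reasoning)
open import Data.List.Relation.Binary.Permutation.Setoid.Properties (setoid ℕ) using (Unique-resp-↭)

private
  variable
    a b c m o t x y z : ℕ
    p π ρ σ w : List ℕ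

<ᵇ-true : ∀ {m n} → m < n → (m <ᵇ n) ≡ true
<ᵇ-true m<n = Equivalence.to T-≡ (<⇒<ᵇ m<n)

<ᵇ-false : ∀ {m n} → n ≤ m → (m <ᵇ n) ≡ false
<ᵇ-false {m} {n} n≤m = ¬-not {y = true} (λ e → <⇒≱ (<ᵇ⇒< m n (Equivalence.from T-≡ e)) n≤m)

<ᵇ-+ : ∀ c x y → (x + c <ᵇ y + c) ≡ (x <ᵇ y)
<ᵇ-+ c x y rewrite +-comm x c | +-comm y c = +-<ᵇ c
  where
  +-<ᵇ : ∀ c → (c + x <ᵇ c + y) ≡ (x <ᵇ y)
  +-<ᵇ zero    = refl
  +-<ᵇ (suc c) = +-<ᵇ c

All≤⇒countLess≡0 : All (x ≤_) w → countLess x w ≡ 0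
All≤⇒countLess≡0 []                      = refl
All≤⇒countLess≡0 {x} (_∷_ {y} x≤y x≤w) rewrite <ᵇ-false {y} {x} x≤y = All≤⇒countLess≡0 x≤w

countLess-mono : ∀ w → x ≤ z → countLess x w ≤ countLess z w
countLess-mono [] _ = z≤n
countLess-mono {x} {z} (y ∷ w) x≤z with y <ᵇ x in y<x | y <ᵇ z in y<z
... | true  | true  = s≤s (countLess-mono w x≤z)
... | false | true  = m≤n⇒m≤1+n (countLess-mono w x≤z)
... | false | false = countLess-mono w x≤z
... | true  | false = ⊥-elim (subst T y<z (<⇒<ᵇ (<-≤-trans (<ᵇ⇒< y x (subst T (sym y<x) tt)) x≤z)))

countLess-+ : ∀ c x w → countLess (x + c) (map (_+ c) w) ≡ countLess x w
countLess-+ c x []      = refl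
countLess-+ c x (y ∷ w) rewrite <ᵇ-+ c y x | countLess-+ c x w = refl

red-map-+ : ∀ c w → red (map (_+ c) w) ≡ red w
red-map-+ c w = begin
  map (λ x → suc (countLess x (map (_+ c) w))) (map (_+ c) w)
    ≡⟨ sym (map-∘ w) ⟩
  map (λ x → suc (countLess (x + c) (map (_+ c) w))) w
    ≡⟨ map-cong (λ x → cong suc (countLess-+ c x w)) w ⟩
  red w ∎
  where open ≡-Reasoning

-- Layered o π: π is a direct sum of copies of 1 and 21 with every value shifted up by o,
-- i.e. a permutation of o+1, …, o+length π.
data Layered : ℕ → List ℕ → Set where
  nil     : Layered o []
  layer1  : Layered (suc o) π → Layered o (suc o ∷ π)
  layer21 : Layered (2 + o) π → Layered o (2 + o ∷ suc o ∷ π)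

Layered-bound : Layered o π → All (o <_) π
Layered-bound nil         = []
Layered-bound (layer1 l)  = n<1+n _ ∷ All.map (<-trans (n<1+n _)) (Layered-bound l)
Layered-bound {o} (layer21 l) =
  n≤1+n (suc o) ∷ n<1+n o ∷ All.map (<-trans (n≤1+n (suc o))) (Layered-bound l)

countLess-Layered : Layered o w → x ∈ w → o + suc (countLess x w) ≡ x
countLess-Layered {o} (layer1 l) (here refl)
  rewrite <ᵇ-false {suc o} {suc o} ≤-refl | All≤⇒countLess≡0 (All.map <⇒≤ (Layered-bound l)) = +-comm o 1
countLess-Layered {o} {x = x} (layer1 {π = π} l) (there x∈π)
  rewrite <ᵇ-true (All.lookup (Layered-bound l) x∈π) =
  trans (+-suc o (suc (countLess x π))) (countLess-Layered l x∈π)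
countLess-Layered {o} (layer21 l) (here refl)
  rewrite <ᵇ-false {suc o} {suc o} ≤-refl | <ᵇ-true {suc o} {2 + o} ≤-refl
        | All≤⇒countLess≡0 (All.map <⇒≤ (Layered-bound l)) = +-comm o 2
countLess-Layered {o} (layer21 l) (there (here refl))
  rewrite <ᵇ-false {2 + o} {suc o} (n≤1+n (suc o)) | <ᵇ-false {suc o} {suc o} ≤-refl
        | All≤⇒countLess≡0 (All.map (<⇒≤ ∘ <-trans (n<1+n (suc o))) (Layered-bound l)) = +-comm o 1
countLess-Layered {o} {x = x} (layer21 {π = π} l) (there (there x∈π))
  rewrite <ᵇ-true (All.lookup (Layered-bound l) x∈π)
        | <ᵇ-true (<-trans (n<1+n (suc o)) (All.lookup (Layered-bound l) x∈π)) = begin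
  o + suc (suc (suc (countLess x π))) ≡⟨ +-suc o _ ⟩
  suc (o + suc (suc (countLess x π))) ≡⟨ cong suc (+-suc o _) ⟩
  2 + o + suc (countLess x π)         ≡⟨ countLess-Layered l x∈π ⟩
  x                                   ∎
  where open ≡-Reasoning

red-Layered : Layered 0 w → red w ≡ w
red-Layered l = map-id-local (All.tabulate (countLess-Layered l))

Layered-+ : ∀ c → Layered o w → Layered (o + c) (map (_+ c) w)
Layered-+ c nil         = nil
Layered-+ c (layer1 l)  = layer1 (Layered-+ c l)
Layered-+ c (layer21 l) = layer21 (Layered-+ c l)

Layered-+⁻ : ∀ o {c} → Layered (o + c) w → ∃[ v ] Layered o v × w ≡ map (_+ c) v
Layered-+⁻ o nil = [] , nil , refl
Layered-+⁻ o (layer1 l) with Layered-+⁻ (suc o) l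
... | v , lv , refl = suc o ∷ v , layer1 lv , refl
Layered-+⁻ o (layer21 l) with Layered-+⁻ (2 + o) l
... | v , lv , refl = 2 + o ∷ suc o ∷ v , layer21 lv , refl

range : ℕ → ℕ → List ℕ
range o zero    = []
range o (suc m) = suc o ∷ range (suc o) m

applyUpTo-range : ∀ {f} o m → (∀ i → f i ≡ suc (o + i)) → applyUpTo f m ≡ range o m
applyUpTo-range o zero    f≗ = refl
applyUpTo-range o (suc m) f≗ = cong₂ _∷_ (trans (f≗ 0) (cong suc (+-identityʳ o)))
  (applyUpTo-range (suc o) m (λ i → trans (f≗ (suc i)) (cong suc (+-suc o i))))

upTo-range : ∀ m → map suc (upTo m) ≡ range 0 m
upTo-range m = trans (map-upTo suc m) (applyUpTo-range 0 m (λ _ → refl))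

∈-range⁻ : ∀ o m → x ∈ range o m → o < x × x ≤ o + m
∈-range⁻ o (suc m) (here refl) = ≤-refl , subst (suc o ≤_) (sym (+-suc o m)) (s≤s (m≤m+n o m))
∈-range⁻ {x} o (suc m) (there x∈) with ∈-range⁻ (suc o) m x∈
... | o<x , x≤ = <⇒≤ o<x , subst (x ≤_) (sym (+-suc o m)) x≤

∈-range⁺ : ∀ o m → o < x → x ≤ o + m → x ∈ range o m
∈-range⁺ {x} o zero    o<x x≤o+0 = ⊥-elim (<⇒≱ o<x (subst (x ≤_) (+-identityʳ o) x≤o+0))
∈-range⁺ {x} o (suc m) o<x x≤    with x ≟ suc o
... | yes refl = here refl
... | no x≢1+o = there (∈-range⁺ (suc o) m (≤∧≢⇒< o<x (x≢1+o ∘ sym)) (subst (x ≤_) (+-suc o m) x≤))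

Layered-↭-range : Layered o π → π ↭ range o (length π)
Layered-↭-range nil         = ↭-refl
Layered-↭-range (layer1 l)  = prep _ (Layered-↭-range l)
Layered-↭-range (layer21 l) = swap _ _ (Layered-↭-range l)

red-231 : ∀ {x y z} → z < x → x < y → red (x ∷ y ∷ z ∷ []) ≡ 2 ∷ 3 ∷ 1 ∷ []
red-231 {x} {y} {z} z<x x<y
  rewrite <ᵇ-false {x} {x} ≤-refl | <ᵇ-false (<⇒≤ x<y) | <ᵇ-true z<x
        | <ᵇ-true x<y | <ᵇ-false {y} {y} ≤-refl | <ᵇ-true (<-trans z<x x<y)
        | <ᵇ-false (<⇒≤ z<x) | <ᵇ-false (<⇒≤ (<-trans z<x x<y)) | <ᵇ-false {z} {z} ≤-refl = refl

red-312 : ∀ {x y z} → y < z → z < x → red (x ∷ y ∷ z ∷ []) ≡ 3 ∷ 1 ∷ 2 ∷ []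
red-312 {x} {y} {z} y<z z<x
  rewrite <ᵇ-false {x} {x} ≤-refl | <ᵇ-true (<-trans y<z z<x) | <ᵇ-true z<x
        | <ᵇ-false (<⇒≤ (<-trans y<z z<x)) | <ᵇ-false {y} {y} ≤-refl | <ᵇ-false (<⇒≤ y<z)
        | <ᵇ-false (<⇒≤ z<x) | <ᵇ-true y<z | <ᵇ-false {z} {z} ≤-refl = refl

red-321 : ∀ {x y z} → z < y → y < x → red (x ∷ y ∷ z ∷ []) ≡ 3 ∷ 2 ∷ 1 ∷ []
red-321 {x} {y} {z} z<y y<x
  rewrite <ᵇ-false {x} {x} ≤-refl | <ᵇ-true y<x | <ᵇ-true (<-trans z<y y<x)
        | <ᵇ-false (<⇒≤ y<x) | <ᵇ-false {y} {y} ≤-refl | <ᵇ-true z<y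
        | <ᵇ-false (<⇒≤ (<-trans z<y y<x)) | <ᵇ-false (<⇒≤ z<y) | <ᵇ-false {z} {z} ≤-refl = refl

Contains-descent : c < a → Contains π (a ∷ b ∷ c ∷ []) →
                   ∃[ x ] ∃[ y ] ∃[ z ] (x ∷ y ∷ z ∷ []) ⊆ π × z < x
Contains-descent c<a (x ∷ y ∷ z ∷ [] , s , refl) =
  x , y , z , s , ≰⇒> (λ x≤z → <⇒≱ c<a (s≤s (countLess-mono (x ∷ y ∷ z ∷ []) x≤z)))

Layered-gap : Layered o π → (x ∷ y ∷ z ∷ []) ⊆ π → x < z
Layered-gap (layer1 l)  (_ ∷ʳ s)        = Layered-gap l s
Layered-gap (layer1 l)  (refl ∷ s)      = All.lookup (Layered-bound l) (lookup s (there (here refl)))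
Layered-gap (layer21 l) (_ ∷ʳ _ ∷ʳ s)   = Layered-gap l s
Layered-gap (layer21 l) (_ ∷ʳ refl ∷ s) =
  <-trans (n<1+n _) (All.lookup (Layered-bound l) (lookup s (there (here refl))))
Layered-gap (layer21 l) (refl ∷ _ ∷ʳ s) = All.lookup (Layered-bound l) (lookup s (there (here refl)))
Layered-gap (layer21 l) (refl ∷ refl ∷ s) = All.lookup (Layered-bound l) (lookup s (here refl))

Layered-avoids : c < a → Layered o π → Avoids π (a ∷ b ∷ c ∷ [])
Layered-avoids c<a l π⊇p with Contains-descent c<a π⊇p
... | _ , _ , _ , s , z<x = <-asym z<x (Layered-gap l s)

Avoids231-312-321 : List ℕ → Set
Avoids231-312-321 π = Avoids π (2 ∷ 3 ∷ 1 ∷ []) × Avoids π (3 ∷ 1 ∷ 2 ∷ []) × Avoids π (3 ∷ 2 ∷ 1 ∷ [])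

Avoids-∷ : Avoids (a ∷ π) p → Avoids π p
Avoids-∷ avoids (σ , σ⊆π , red≡) = avoids (σ , _ ∷ʳ σ⊆π , red≡)

Avoids231-312-321-∷ : Avoids231-312-321 (a ∷ π) → Avoids231-312-321 π
Avoids231-312-321-∷ (A231 , A312 , A321) = Avoids-∷ A231 , Avoids-∷ A312 , Avoids-∷ A321

distinct-∈⇒⊆ : x ∈ π → y ∈ π → x ≢ y → (x ∷ y ∷ []) ⊆ π ⊎ (y ∷ x ∷ []) ⊆ π
distinct-∈⇒⊆ (here refl) (here refl) x≢y = ⊥-elim (x≢y refl)
distinct-∈⇒⊆ (here refl) (there y∈) _   = inj₁ (refl ∷ from∈ y∈)
distinct-∈⇒⊆ (there x∈) (here refl) _   = inj₂ (refl ∷ from∈ x∈)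
distinct-∈⇒⊆ (there x∈) (there y∈) x≢y with distinct-∈⇒⊆ x∈ y∈ x≢y
... | inj₁ s = inj₁ (_ ∷ʳ s)
... | inj₂ s = inj₂ (_ ∷ʳ s)

-- If the first entry is not o+1, then o+1 and o+2 both come later, and unless a = o+2
-- they form a 312 or a 321 with a.
avoider-head : (a ∷ π) ↭ range o (suc m) → Avoids (a ∷ π) (3 ∷ 1 ∷ 2 ∷ []) →
               Avoids (a ∷ π) (3 ∷ 2 ∷ 1 ∷ []) → a ≢ suc o → a ≡ 2 + o
avoider-head {a} {π} {o} {m} p A312 A321 a≢1+o with a ≟ 2 + o
... | yes a≡2+o = a≡2+o
... | no a≢2+o  = ⊥-elim (pattern-at-a (distinct-∈⇒⊆ 1+o∈π 2+o∈π (1+n≢n ∘ sym)))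
  where
  a∈ : a ∈ range o (suc m)
  a∈ = ∈-resp-↭ p (here refl)
  2+o<a : 2 + o < a
  2+o<a = ≤∧≢⇒< (≤∧≢⇒< (proj₁ (∈-range⁻ o (suc m) a∈)) (a≢1+o ∘ sym)) (a≢2+o ∘ sym)
  1+o∈π : suc o ∈ π
  1+o∈π = Any.tail (a≢1+o ∘ sym) (∈-resp-↭ (↭-sym p) (here refl))
  2+o∈π : 2 + o ∈ π
  2+o∈π = Any.tail (a≢2+o ∘ sym) (∈-resp-↭ (↭-sym p)
            (∈-range⁺ o (suc m) (n≤1+n (suc o)) (≤-trans (<⇒≤ 2+o<a) (proj₂ (∈-range⁻ o (suc m) a∈)))))
  pattern-at-a : (suc o ∷ 2 + o ∷ []) ⊆ π ⊎ (2 + o ∷ suc o ∷ []) ⊆ π → ⊥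
  pattern-at-a (inj₁ s) = A312 (_ , refl ∷ s , red-312 (n<1+n (suc o)) 2+o<a)
  pattern-at-a (inj₂ s) = A321 (_ , refl ∷ s , red-321 (n<1+n (suc o)) 2+o<a)

-- After a first entry o+2, any second entry c ≠ o+1 exceeds o+2, and o+2, c, o+1 is a 231.
avoider-second : (2 + o ∷ π) ↭ range o (suc m) → Unique (2 + o ∷ π) →
                 Avoids (2 + o ∷ π) (2 ∷ 3 ∷ 1 ∷ []) → ∃[ π′ ] π ≡ suc o ∷ π′
avoider-second {o} {[]} p _ _ with ∈-resp-↭ (↭-sym p) (here refl)
... | here 1+o≡2+o = ⊥-elim (1+n≢n (sym 1+o≡2+o))
avoider-second {o} {c ∷ π} {m} p u A231 with c ≟ suc o
... | yes refl   = π , refl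
... | no c≢1+o = ⊥-elim (A231 (_ , refl ∷ refl ∷ from∈ 1+o∈π , red-231 (n<1+n (suc o)) 2+o<c))
  where
  1+o∈π : suc o ∈ π
  1+o∈π = Any.tail (c≢1+o ∘ sym) (Any.tail (1+n≢n ∘ sym) (∈-resp-↭ (↭-sym p) (here refl)))
  2+o<c : 2 + o < c
  2+o<c = ≤∧≢⇒< (≤∧≢⇒< (proj₁ (∈-range⁻ o (suc m) (∈-resp-↭ p (there (here refl))))) (c≢1+o ∘ sym))
                (All.head (AllPairs.head u))

Avoider⇒Layered : ∀ π → π ↭ range o (length π) → Unique π → Avoids231-312-321 π → Layered o π
Avoider⇒Layered [] _ _ _ = nil
Avoider⇒Layered {o} (a ∷ π) p u av with a ≟ suc o
... | yes refl = layer1 (Avoider⇒Layered π (drop-∷ p) (AllPairs.tail u) (Avoids231-312-321-∷ av))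
... | no a≢1+o with avoider-head p (proj₁ (proj₂ av)) (proj₂ (proj₂ av)) a≢1+o
... | refl with avoider-second p u (proj₁ av)
... | π′ , refl = layer21 (Avoider⇒Layered π′ (drop-∷ (drop-∷ (↭-trans (swap (suc o) (2 + o) ↭-refl) p)))
                           (AllPairs.tail (AllPairs.tail u))
                           (Avoids231-312-321-∷ (Avoids231-312-321-∷ av)))

𝒫⇒Layered : ∀ n → 𝒫 n π → Layered 0 π × length π ≡ 3 * n × Blocks π
𝒫⇒Layered {π} n (p , A231 , A312 , A321 , blocks) =
  Avoider⇒Layered π p′ unique (A231 , A312 , A321) , length≡ , blocks
  where
  length≡ : length π ≡ 3 * n
  length≡ = trans (↭-length p) (trans (length-map suc (upTo (3 * n))) (length-upTo (3 * n)))
  p′ : π ↭ range 0 (length π)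
  p′ = subst (λ m → π ↭ range 0 m) (sym length≡) (subst (π ↭_) (upTo-range (3 * n)) p)
  unique : Unique π
  unique = Unique-resp-↭ (↭⇒↭ₛ (↭-sym p)) (map⁺ suc-injective (upTo⁺ (3 * n)))

Layered⇒𝒫 : ∀ n → Layered 0 π → length π ≡ 3 * n → Blocks π → 𝒫 n π
Layered⇒𝒫 {π} n l length≡ blocks =
  subst (π ↭_) (sym (trans (upTo-range (3 * n)) (cong (range 0) (sym length≡)))) (Layered-↭-range l) ,
  Layered-avoids (s<s z<s) l , Layered-avoids (n<1+n 2) l , Layered-avoids (s<s z<s) l , blocks

Blocks-head< : Blocks (a ∷ b ∷ w) → a < b
Blocks-head< {w = _ ∷ _} ((a<b , _) , _) = a<b

Blocks-∷-head : All (t <_) w → Blocks (x ∷ w) → Blocks (t ∷ w)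
Blocks-∷-head (t<a ∷ t<b ∷ _) (_ , blocks) = (t<a , t<b) , blocks

Blocks-map⁺ : ∀ {f : ℕ → ℕ} → (∀ {x y} → x < y → f x < f y) → Blocks w → Blocks (map f w)
Blocks-map⁺ {[]}            f-mono _                  = tt
Blocks-map⁺ {a ∷ b ∷ c ∷ w} f-mono ((a<b , a<c) , bl) = (f-mono a<b , f-mono a<c) , Blocks-map⁺ {w} f-mono bl

Blocks-map⁻ : ∀ {f : ℕ → ℕ} w → (∀ {x y} → f x < f y → x < y) → Blocks (map f w) → Blocks w
Blocks-map⁻ []              f-reflects _                  = tt
Blocks-map⁻ (a ∷ b ∷ c ∷ w) f-reflects ((a<b , a<c) , bl) = (f-reflects a<b , f-reflects a<c) , Blocks-map⁻ w f-reflects bl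

-- The ρ with 1 ⊕ ρ ∈ 𝒫_{3n} are exactly those with Tail 0 (3n-1) ρ.
Tail : ℕ → ℕ → List ℕ → Set
Tail o m w = Layered o w × length w ≡ m × Blocks (o ∷ w)

Tail-+ : ∀ c → Tail o m w → Tail (o + c) m (map (_+ c) w)
Tail-+ {w = w} c (l , length≡ , blocks) =
  Layered-+ c l , trans (length-map _ w) length≡ , Blocks-map⁺ (+-monoˡ-< c) blocks

Tail-+⁻ : ∀ o {c} → Tail (o + c) m w → ∃[ v ] Tail o m v × w ≡ map (_+ c) v
Tail-+⁻ o {c} (l , length≡ , blocks) with Layered-+⁻ o l
... | v , lv , refl =
  v , (lv , trans (sym (length-map _ v)) length≡ , Blocks-map⁻ (o ∷ v) (+-cancelʳ-< c _ _) blocks) , refl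

𝒫-suc⁻ : ∀ k → 𝒫 (suc k) σ → ∃[ ρ ] Tail 0 (2 + 3 * k) ρ × σ ≡ (1 ∷ []) ⊕ ρ
𝒫-suc⁻ k σ∈𝒫 with 𝒫⇒Layered (suc k) σ∈𝒫
... | layer21 _ , _ , blocks = ⊥-elim (<-asym (Blocks-head< blocks) (n<1+n 1))
... | layer1 l , length≡ , blocks with Tail-+⁻ 0 (l , suc-injective (trans length≡ (*-suc 3 k)) , blocks)
... | ρ , tail , refl = ρ , tail , refl

𝒫-suc⁺ : ∀ k → Tail 0 (2 + 3 * k) ρ → 𝒫 (suc k) ((1 ∷ []) ⊕ ρ)
𝒫-suc⁺ k tail with Tail-+ 1 tail
... | l , length≡ , blocks = Layered⇒𝒫 (suc k) (layer1 l) (trans (cong suc length≡) (sym (*-suc 3 k))) blocks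

Tail-2 : Tail 0 2 ρ → ρ ≡ 1 ∷ 2 ∷ [] ⊎ ρ ≡ 2 ∷ 1 ∷ []
Tail-2 (layer1 (layer1 nil) , _)             = inj₁ refl
Tail-2 (layer21 nil , _)                     = inj₂ refl
Tail-2 (layer1 (layer1 (layer1 _)) , () , _)
Tail-2 (layer1 (layer1 (layer21 _)) , () , _)
Tail-2 (layer1 (layer21 _) , () , _)
Tail-2 (layer21 (layer1 _) , () , _)
Tail-2 (layer21 (layer21 _) , () , _)

layered₃ : List (List ℕ)
layered₃ = (1 ∷ 2 ∷ 3 ∷ []) ∷ (1 ∷ 3 ∷ 2 ∷ []) ∷ (2 ∷ 1 ∷ 3 ∷ []) ∷ []

Tail-⊕ : ∀ {τ} → τ ∈ layered₃ → Tail 0 m ρ → Tail 0 (3 + m) (τ ⊕ ρ)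
Tail-⊕ (here refl) tail with Tail-+ 3 tail
... | l , length≡ , blocks = layer1 (layer1 (layer1 l)) , cong (3 +_) length≡ , (z<s , z<s) , blocks
Tail-⊕ (there (here refl)) tail with Tail-+ 3 tail
... | l , length≡ , blocks = layer1 (layer21 l) , cong (3 +_) length≡ , (z<s , z<s) ,
                             Blocks-∷-head (All.map (<-trans (n<1+n 2)) (Layered-bound l)) blocks
Tail-⊕ (there (there (here refl))) tail with Tail-+ 3 tail
... | l , length≡ , blocks = layer21 (layer1 l) , cong (3 +_) length≡ , (z<s , z<s) , blocks

-- A layer 21 at positions 3 and 4 of ρ would violate the block condition there.
Tail-split : Tail 0 (3 + m) ρ → ∃[ τ ] ∃[ ρ′ ] τ ∈ layered₃ × Tail 0 m ρ′ × ρ ≡ τ ⊕ ρ′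
Tail-split (layer1 (layer1 (layer1 l)) , length≡ , _ , blocks)
  with Tail-+⁻ 0 (l , +-cancelˡ-≡ 3 _ _ length≡ , blocks)
... | ρ′ , tail , refl = _ , ρ′ , here refl , tail , refl
Tail-split (layer1 (layer21 l) , length≡ , _ , blocks)
  with Tail-+⁻ 0 (l , +-cancelˡ-≡ 3 _ _ length≡ , Blocks-∷-head (Layered-bound l) blocks)
... | ρ′ , tail , refl = _ , ρ′ , there (here refl) , tail , refl
Tail-split (layer21 (layer1 l) , length≡ , _ , blocks)
  with Tail-+⁻ 0 (l , +-cancelˡ-≡ 3 _ _ length≡ , blocks)
... | ρ′ , tail , refl = _ , ρ′ , there (there (here refl)) , tail , refl
Tail-split (layer1 (layer1 (layer21 _)) , _ , _ , blocks) = ⊥-elim (<-asym (Blocks-head< blocks) (n<1+n 3))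
Tail-split (layer21 (layer21 _) , _ , _ , blocks)         = ⊥-elim (<-asym (Blocks-head< blocks) (n<1+n 3))
Tail-split (nil , () , _)
Tail-split (layer1 nil , () , _)
Tail-split (layer1 (layer1 nil) , () , _)
Tail-split (layer21 nil , () , _)

⊕-assoc : ∀ α β γ → α ⊕ β ⊕ γ ≡ α ⊕ (β ⊕ γ)
⊕-assoc α β γ = begin
  (α ++ map (_+ ∣α∣) β) ++ map (_+ length (α ++ map (_+ ∣α∣) β)) γ
    ≡⟨ cong (λ n → (α ++ map (_+ ∣α∣) β) ++ map (_+ n) γ) length-α⊕β ⟩
  (α ++ map (_+ ∣α∣) β) ++ map (_+ (∣β∣ + ∣α∣)) γ
    ≡⟨ ++-assoc α _ _ ⟩
  α ++ (map (_+ ∣α∣) β ++ map (_+ (∣β∣ + ∣α∣)) γ)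
    ≡⟨ cong (λ δ → α ++ (map (_+ ∣α∣) β ++ δ)) (trans (map-cong (λ x → sym (+-assoc x ∣β∣ ∣α∣)) γ) (map-∘ γ)) ⟩
  α ++ (map (_+ ∣α∣) β ++ map (_+ ∣α∣) (map (_+ ∣β∣) γ))
    ≡⟨ cong (α ++_) (sym (map-++ (_+ ∣α∣) β _)) ⟩
  α ⊕ (β ⊕ γ) ∎
  where
  open ≡-Reasoning
  ∣α∣ ∣β∣ : ℕ
  ∣α∣ = length α
  ∣β∣ = length β
  length-α⊕β : length (α ++ map (_+ ∣α∣) β) ≡ ∣β∣ + ∣α∣
  length-α⊕β = trans (length-++ α) (trans (cong (∣α∣ +_) (length-map _ β)) (+-comm ∣α∣ ∣β∣))

mainTheorem4 : (k : ℕ) (π : List ℕ) → P k π ⇔ 𝒫 (suc k) π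
mainTheorem4 zero π = mk⇔ to from
  where
  to : P 0 π → 𝒫 1 π
  to (inj₁ refl) = 𝒫-suc⁺ 0 (layer1 (layer1 nil) , refl , (z<s , z<s) , tt)
  to (inj₂ refl) = 𝒫-suc⁺ 0 (layer21 nil , refl , (z<s , z<s) , tt)
  from : 𝒫 1 π → P 0 π
  from π∈𝒫 with 𝒫-suc⁻ 0 π∈𝒫
  ... | ρ , tail , refl with Tail-2 tail
  ... | inj₁ refl = inj₁ refl
  ... | inj₂ refl = inj₂ refl
mainTheorem4 (suc k) π = mk⇔ to from
  where
  tail-length : 3 + (2 + 3 * k) ≡ 2 + 3 * suc k
  tail-length = sym (cong (2 +_) (*-suc 3 k))
  red-tail : ∀ {ρ} → Layered 0 ρ → red (drop 1 ((1 ∷ []) ⊕ ρ)) ≡ ρ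
  red-tail {ρ} l = trans (red-map-+ 1 ρ) (red-Layered l)
  to : P (suc k) π → 𝒫 (suc (suc k)) π
  to (τ , σ , τ∈ , σ∈𝒫 , refl) with 𝒫-suc⁻ k σ∈𝒫
  ... | ρ , tail , refl =
    subst (𝒫 (suc (suc k))) (sym (trans (cong (((1 ∷ []) ⊕ τ) ⊕_) (red-tail (proj₁ tail))) (⊕-assoc (1 ∷ []) τ ρ)))
      (𝒫-suc⁺ (suc k) (subst (λ m → Tail 0 m (τ ⊕ ρ)) tail-length (Tail-⊕ τ∈ tail)))
  from : 𝒫 (suc (suc k)) π → P (suc k) π
  from π∈𝒫 with 𝒫-suc⁻ (suc k) π∈𝒫
  ... | ρ , tail , refl with Tail-split (subst (λ m → Tail 0 m ρ) (sym tail-length) tail)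
  ... | τ , ρ′ , τ∈ , tail′ , refl =
    τ , (1 ∷ []) ⊕ ρ′ , τ∈ , 𝒫-suc⁺ k tail′ ,
    trans (sym (⊕-assoc (1 ∷ []) τ ρ′)) (cong (((1 ∷ []) ⊕ τ) ⊕_) (sym (red-tail (proj₁ tail′))))
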